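{- Let $\phi=v_1,\ldots,v_n$ be a realizing topological ordering for a degree sequence $\mathcal{S}$ (with realizing dag $D$), and let $1\le i\le n$ with $\omega(p^\phi_i)\ge\Delta^2$. Then for any partial topological ordering $\phi'$ for a degree sequence $\mathcal{S}'$ with input potential $0^\Delta$ and output potential $p$ with $\omega(p)=\omega(p^\phi_i)$, the sequence $\phi'\phi[i+1,n]$ is a realizing topological ordering for $\mathcal{S}'\uplus\{\binom{d^-(v_{i+1})}{d^+(v_{i+1})},\ldots,\binom{d^-(v_n)}{d^+(v_n)}\}$, where $d^-,d^+$ denote in- and outdegrees in $D$.
   Context: Fix a positive integer $\Delta$; all degrees are at most $\Delta$. A degree sequence is a multiset of pairs $\binom{a}{b}$ of nonnegative integers ($a$ indegree, $b$ outdegree); $\uplus$ is multiset sum. A dag (directed acyclic graph without parallel arcs and self-loops) realizes it if its vertices are in bijection with the elements with matching in/outdegrees. A topological ordering of a dag orders all vertices so that all arcs go forward; a realizing topological ordering for $\mathcal{S}$ is a topological ordering of some dag realizing $\mathcal{S}$; a sequence of elements (vertices with prescribed degrees) is a realizing topological ordering for a degree sequence if there is a dag realizing it with the vertices in that order forming a topological ordering. $\phi[i,j]=v_i,\ldots,v_j$; juxtaposition is concatenation. Potential: for a dag with topological ordering $v_1,\ldots,v_n$ and $0\le i\le n$, $p_i\in\mathbb{N}^\Delta$ with $p_i[l]$ the number of vertices among $v_1,\ldots,v_i$ with at least $l$ neighbors among $v_{i+1},\ldots,v_n$; value $\omega(p)=\sum_{l=1}^\Delta p[l]$; $0^\Delta$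 is the zero vector. Partial topological ordering: given a degree sequence $\mathcal{S}$ with $n$ elements and $p^s,p^t\in\mathbb{N}^\Delta$, let $P^s$ be a degree sequence of $p^s[1]$ elements of the form $\binom{0}{b}$ such that for each $1\le l\le\Delta$ exactly $p^s[l]$ of them have $b\ge l$, and let $P^t$ consist of $\omega(p^t)$ elements $\binom{1}{0}$. If $\psi$ is a realizing topological ordering for $\mathcal{S}\uplus P^s\uplus P^t$ in which the vertices of $P^s$ come first and those of $P^t$ come last, and the potential at position $p^s[1]+n$ equals $p^t$, then $\psi[p^s[1]+1,p^s[1]+n]$ is a partial topological ordering for $\mathcal{S}$ with input potential $p^s$ and output potential $p^t$. -}

module Defs where

open import Data.Nat using (ℕ; zero; suc; _+_; _≤_; _<ᵇ_; _≤ᵇ_)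
open import Data.Bool using (Bool; true; false; if_then_else_; _∨_)
open import Data.Fin using (Fin; toℕ)
open import Data.Nat.ListAction using (sum)
open import Data.List using (List; []; _∷_; length; lookup; map; allFin; replicate; _++_)
open import Data.List.Relation.Unary.All using (All)
open import Data.List.Relation.Binary.Permutation.Propositional using (_↭_)
open import Data.Vec using (Vec; tabulate; toList)
open import Data.Product using (_×_; _,_; proj₁; proj₂; Σ; ∃)
open import Relation.Binary.PropositionalEquality using (_≡_)

-- An element of a degree sequence: (indegree , outdegree).
Deg : Set
Deg = ℕ × ℕ

countFin : {n : ℕ} → (Fin n → Bool) → ℕ
countFin {n} f = sum (map (λ j → if f j then 1 else 0) (allFin n))

countL : {A : Set} → (A → Bool) → List A → ℕ
countL f []       = 0
countL f (x ∷ xs) = (if f x then 1 else 0) + countL f xs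

-- A simple digraph on vertex set Fin n (no parallel arcs by construction):
-- Adj u v = true iff there is an arc u → v.
Adj : ℕ → Set
Adj n = Fin n → Fin n → Bool

indeg : {n : ℕ} → Adj n → Fin n → ℕ
indeg A v = countFin (λ u → A u v)

outdeg : {n : ℕ} → Adj n → Fin n → ℕ
outdeg A u = countFin (λ v → A u v)

-- All arcs go forward w.r.t. the order of Fin n (so the digraph is a dag,
-- without self-loops, and 0,1,…,n-1 is a topological ordering of it).
Forward : {n : ℕ} → Adj n → Set
Forward A = ∀ u v → A u v ≡ true → toℕ u Data.Nat.< toℕ v

-- The dag A realizes the sequence ψ with vertex k corresponding to the
-- k-th element of ψ, and this order is a topological ordering of A.
RealizesInOrder : (ψ : List Deg) → Adj (length ψ) → Set
RealizesInOrder ψ A =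
  Forward A ×
  (∀ k → indeg A k ≡ proj₁ (lookup ψ k) × outdeg A k ≡ proj₂ (lookup ψ k))

Bounded : ℕ → List Deg → Set
Bounded Δ ψ = All (λ d → proj₁ d ≤ Δ × proj₂ d ≤ Δ) ψ

IsRTO : ℕ → List Deg → Set
IsRTO Δ ψ = Bounded Δ ψ × Σ (Adj (length ψ)) (RealizesInOrder ψ)

RTOFor : ℕ → List Deg → List Deg → Set
RTOFor Δ ψ S = ψ ↭ S × IsRTO Δ ψ

-- Number of neighbours of vertex k among the vertices at positions ≥ i
-- (0-based positions; i.e. among v_{i+1},…,v_n in 1-based notation).
nbrsAfter : {n : ℕ} → Adj n → ℕ → Fin n → ℕ
nbrsAfter A i k = countFin (λ j → (i ≤ᵇ toℕ j) Data.Bool.∧ (A k j ∨ A j k))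

-- Potential p_i : entry l (0-based index, standing for l+1 in the paper)
-- counts vertices among v_1,…,v_i with at least l+1 neighbours among v_{i+1},…,v_n.
potential : (Δ : ℕ) {n : ℕ} → Adj n → ℕ → Vec ℕ Δ
potential Δ A i =
  tabulate (λ l → countFin (λ k → (toℕ k <ᵇ i) Data.Bool.∧ (suc (toℕ l) ≤ᵇ nbrsAfter A i k)))

ω : {Δ : ℕ} → Vec ℕ Δ → ℕ
ω p = sum (toList p)

zeroPot : (Δ : ℕ) → Vec ℕ Δ
zeroPot Δ = Data.Vec.replicate Δ 0

-- P^s given by the list of outdegrees bs of its elements (0 , b):
-- it has p^s[1] elements and exactly p^s[l] of them have b ≥ l, for 1 ≤ l ≤ Δ.
-- (Having p^s[1] elements, of which p^s[1] have b ≥ 1, means all have b ≥ 1.)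
SourcePart : (Δ : ℕ) → Vec ℕ Δ → List ℕ → Set
SourcePart Δ ps bs =
  All (λ b → 1 ≤ b) bs ×
  (∀ (l : Fin Δ) → countL (λ b → suc (toℕ l) ≤ᵇ b) bs ≡ Data.Vec.lookup ps l)

PartialTO : (Δ : ℕ) → List Deg → Vec ℕ Δ → Vec ℕ Δ → List Deg → Set
PartialTO Δ S ps pt φ =
  φ ↭ S ×
  Σ (List ℕ) λ bs → SourcePart Δ ps bs ×
    (let ψ = map (λ b → (0 , b)) bs ++ φ ++ replicate (ω pt) (1 , 0) in
     Bounded Δ ψ ×
     Σ (Adj (length ψ)) λ A →
       RealizesInOrder ψ A × potential Δ A (length bs + length φ) ≡ pt)

-- The potential ω(p_i) of D counts the arcs of D from v_1,…,v_i to v_{i+1},…,v_n,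
-- and ω(p) counts the arcs entering the ω(p) sinks appended to φ'.  Cutting both
-- families of arcs, the vertices of φ' lack c_u outgoing arcs and those of
-- φ[i+1,n] lack r_y incoming arcs, where every c_u, r_y is at most Δ and
-- Σ c_u = Σ r_y ≥ Δ².  Such a pair of degree sequences is realised by a simple
-- bipartite graph, and adding its arcs from φ' to φ[i+1,n] gives a dag realising
-- φ'φ[i+1,n] in this order.

module Submission where

open import Defs

open import Data.Bool using (Bool; true; false; if_then_else_; _∧_; _∨_)
open import Data.Bool.Properties using (T-≡; ¬-not; ∨-identityʳ)
open import Data.Empty using (⊥; ⊥-elim)
open import Data.Fin using (Fin; toℕ; fromℕ<) renaming (zero to fzero; suc to fsuc)
open import Data.Fin.Properties using (toℕ-fromℕ<; fromℕ<-toℕ; toℕ<n)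
open import Data.List using (List; []; _∷_; length; lookup; tabulate; replicate; drop; _++_)
open import Data.List.Properties using (map-tabulate; length-++; length-drop)
open import Data.List.Relation.Unary.All using (_∷_)
import Data.List.Relation.Unary.All.Properties as All
open import Data.List.Relation.Binary.Permutation.Propositional using (_↭_)
import Data.List.Relation.Binary.Permutation.Propositional.Properties as ↭
open import Data.Nat
open import Data.Nat.DivMod using (m≡m%n+[m/n]*n; m%n<n)
open import Data.Nat.ListAction using (sum)
open import Data.Nat.Properties
open import Data.Nat.Tactic.RingSolver using (solve-∀)
open import Data.Product using (_×_; _,_; Σ; proj₁; proj₂)
open import Data.Sum using (_⊎_; inj₁; inj₂)
open import Data.Vec using (Vec)
import Data.Vec as Vec
open import Function using (_∘_; Equivalence)
open import Relation.Binary.Definitions using (tri<; tri≈; tri>)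
open import Relation.Binary.PropositionalEquality
open import Relation.Nullary using (yes; no)

-- Sums and counts over initial segments of ℕ

𝟙 : Bool → ℕ
𝟙 b = if b then 1 else 0

∑ : ℕ → (ℕ → ℕ) → ℕ
∑ zero    f = 0
∑ (suc n) f = f 0 + ∑ n (f ∘ suc)

syntax ∑ n (λ j → e) = ∑[ j < n ] e

# : ℕ → (ℕ → Bool) → ℕ
# n P = ∑[ j < n ] 𝟙 (P j)

syntax # n (λ j → e) = #[ j < n ] e

∑-cong : ∀ n {f g : ℕ → ℕ} → (∀ j → j < n → f j ≡ g j) → ∑ n f ≡ ∑ n g
∑-cong zero    f≡g = refl
∑-cong (suc n) f≡g = cong₂ _+_ (f≡g 0 z<s) (∑-cong n (λ j j<n → f≡g (suc j) (s<s j<n)))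

#-cong : ∀ n {P Q : ℕ → Bool} → (∀ j → j < n → P j ≡ Q j) → # n P ≡ # n Q
#-cong n P≡Q = ∑-cong n (λ j j<n → cong 𝟙 (P≡Q j j<n))

∑-zero : ∀ n {f : ℕ → ℕ} → (∀ j → j < n → f j ≡ 0) → ∑ n f ≡ 0
∑-zero zero    f≡0 = refl
∑-zero (suc n) f≡0 = cong₂ _+_ (f≡0 0 z<s) (∑-zero n (λ j j<n → f≡0 (suc j) (s<s j<n)))

#-false : ∀ n {P : ℕ → Bool} → (∀ j → j < n → P j ≡ false) → # n P ≡ 0
#-false n P≡false = ∑-zero n (λ j j<n → cong 𝟙 (P≡false j j<n))

∑-+ : ∀ a b (f : ℕ → ℕ) → ∑ (a + b) f ≡ ∑ a f + ∑[ j < b ] f (a + j)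
∑-+ zero    b f = refl
∑-+ (suc a) b f = trans (cong (f 0 +_) (∑-+ a b (f ∘ suc))) (sym (+-assoc (f 0) _ _))

∑-suc : ∀ n (f : ℕ → ℕ) → ∑ (suc n) f ≡ ∑ n f + f n
∑-suc n f = begin
  ∑ (suc n) f              ≡⟨ cong (λ k → ∑ k f) (+-comm 1 n) ⟩
  ∑ (n + 1) f              ≡⟨ ∑-+ n 1 f ⟩
  ∑ n f + (f (n + 0) + 0)  ≡⟨ cong (λ k → ∑ n f + k) (trans (+-identityʳ _) (cong f (+-identityʳ n))) ⟩
  ∑ n f + f n              ∎
  where open ≡-Reasoning

∑-distrib-+ : ∀ n (f g : ℕ → ℕ) → ∑[ j < n ] (f j + g j) ≡ ∑ n f + ∑ n g
∑-distrib-+ zero    f g = refl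
∑-distrib-+ (suc n) f g
  rewrite ∑-distrib-+ n (f ∘ suc) (g ∘ suc) = interchange (f 0) (g 0) _ _
  where
  interchange : ∀ a b c d → (a + b) + (c + d) ≡ (a + c) + (b + d)
  interchange = solve-∀

∑-comm : ∀ a b (h : ℕ → ℕ → ℕ) → ∑[ i < a ] ∑[ j < b ] h i j ≡ ∑[ j < b ] ∑[ i < a ] h i j
∑-comm zero    b h = sym (∑-zero b (λ _ _ → refl))
∑-comm (suc a) b h = trans (cong (∑[ j < b ] h 0 j +_) (∑-comm a b (h ∘ suc)))
  (sym (∑-distrib-+ b (h 0) (λ j → ∑[ i < a ] h (suc i) j)))

∑-*ˡ : ∀ n k (f : ℕ → ℕ) → ∑[ j < n ] (k * f j) ≡ k * ∑ n f
∑-*ˡ zero    k f = sym (*-zeroʳ k)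
∑-*ˡ (suc n) k f = trans (cong (k * f 0 +_) (∑-*ˡ n k (f ∘ suc))) (sym (*-distribˡ-+ k (f 0) _))

∑-mono-≤ : ∀ n {f g : ℕ → ℕ} → (∀ j → j < n → f j ≤ g j) → ∑ n f ≤ ∑ n g
∑-mono-≤ zero    f≤g = z≤n
∑-mono-≤ (suc n) f≤g = +-mono-≤ (f≤g 0 z<s) (∑-mono-≤ n (λ j j<n → f≤g (suc j) (s<s j<n)))

∑-mono-≤-≡⇒≡ : ∀ n {f g : ℕ → ℕ} → (∀ j → j < n → f j ≤ g j) → ∑ n f ≡ ∑ n g →
               ∀ j → j < n → f j ≡ g j
∑-mono-≤-≡⇒≡ (suc n) {f} {g} f≤g ∑f≡∑g = pointwise
  where
  tail≤ : (∀ j → j < n → f (suc j) ≤ g (suc j))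
  tail≤ j j<n = f≤g (suc j) (s<s j<n)
  head≡ : f 0 ≡ g 0
  head≡ = ≤-antisym (f≤g 0 z<s) (+-cancelʳ-≤ _ _ _
    (≤-trans (≤-reflexive (sym ∑f≡∑g)) (+-monoʳ-≤ (f 0) (∑-mono-≤ n tail≤))))
  tail≡ : ∑ n (f ∘ suc) ≡ ∑ n (g ∘ suc)
  tail≡ = +-cancelˡ-≡ (f 0) _ _ (trans ∑f≡∑g (cong (_+ _) (sym head≡)))
  pointwise : ∀ j → j < suc n → f j ≡ g j
  pointwise zero    _         = head≡
  pointwise (suc j) (s<s j<n) = ∑-mono-≤-≡⇒≡ n tail≤ tail≡ j j<n

∑-suc-≤ : ∀ {y n} (f : ℕ → ℕ) → y < n → ∑ y f + f y ≤ ∑ n f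
∑-suc-≤ {y} {n} f y<n = begin
  ∑ y f + f y                                      ≡⟨ sym (∑-suc y f) ⟩
  ∑ (suc y) f                                      ≤⟨ m≤m+n (∑ (suc y) f) _ ⟩
  ∑ (suc y) f + ∑[ j < n ∸ suc y ] f (suc y + j)   ≡⟨ sym (∑-+ (suc y) (n ∸ suc y) f) ⟩
  ∑ (suc y + (n ∸ suc y)) f                        ≡⟨ cong (λ k → ∑ k f) (m+[n∸m]≡n y<n) ⟩
  ∑ n f                                            ∎
  where open ≤-Reasoning

#≤1 : ∀ m (P : ℕ → Bool) → (∀ x x' → x < m → x' < m → P x ≡ true → P x' ≡ true → x ≡ x') →
      # m P ≤ 1
#≤1 zero    P unique = z≤n
#≤1 (suc m) P unique with P 0 in P0
... | true  = ≤-reflexive (cong suc (#-false m (λ j j<m → ¬-not (λ Psj → 0≢1+n (unique 0 (suc j) z<s (s<s j<m) P0 Psj)))))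
... | false = #≤1 m (P ∘ suc) (λ x x' x<m x'<m Px Px' → suc-injective (unique (suc x) (suc x') (s<s x<m) (s<s x'<m) Px Px'))

∑-select : ∀ n (f : ℕ → ℕ) {p} → p < n → ∑[ t < n ] (𝟙 (p ≡ᵇ t) * f t) ≡ f p
∑-select (suc n) f {zero}  _         =
  trans (cong (f 0 + 0 +_) (∑-zero n (λ _ _ → refl))) (trans (+-identityʳ _) (+-identityʳ _))
∑-select (suc n) f {suc p} (s<s p<n) = ∑-select n (f ∘ suc) p<n

∑-reindex-≤ : ∀ m n (τ : ℕ → ℕ) → (∀ x → x < m → τ x < n) →
              (∀ x x' → x < m → x' < m → τ x ≡ τ x' → x ≡ x') →
              ∀ f → ∑[ x < m ] f (τ x) ≤ ∑ n f
∑-reindex-≤ m n τ τ< τ-injective f = begin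
  ∑[ x < m ] f (τ x)                              ≡⟨ ∑-cong m (λ x x<m → sym (∑-select n f (τ< x x<m))) ⟩
  ∑[ x < m ] ∑[ t < n ] (𝟙 (τ x ≡ᵇ t) * f t)      ≡⟨ ∑-comm m n _ ⟩
  ∑[ t < n ] ∑[ x < m ] (𝟙 (τ x ≡ᵇ t) * f t)      ≡⟨ ∑-cong n (λ t _ → trans (∑-cong m (λ x _ → *-comm (𝟙 (τ x ≡ᵇ t)) (f t))) (∑-*ˡ m (f t) _)) ⟩
  ∑[ t < n ] (f t * #[ x < m ] (τ x ≡ᵇ t))        ≤⟨ ∑-mono-≤ n (λ t _ → *-monoʳ-≤ (f t) (#≤1 m _ (fibre t))) ⟩
  ∑[ t < n ] (f t * 1)                            ≡⟨ ∑-cong n (λ t _ → *-identityʳ (f t)) ⟩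
  ∑ n f                                           ∎
  where
  open ≤-Reasoning
  fibre : ∀ t x x' → x < m → x' < m → (τ x ≡ᵇ t) ≡ true → (τ x' ≡ᵇ t) ≡ true → x ≡ x'
  fibre t x x' x<m x'<m τx≡t τx'≡t = τ-injective x x' x<m x'<m
    (trans (≡ᵇ⇒≡ _ _ (Equivalence.from T-≡ τx≡t)) (sym (≡ᵇ⇒≡ _ _ (Equivalence.from T-≡ τx'≡t))))

<⇒<ᵇ≡true : ∀ {m n} → m < n → (m <ᵇ n) ≡ true
<⇒<ᵇ≡true m<n = Equivalence.to T-≡ (<⇒<ᵇ m<n)

≥⇒<ᵇ≡false : ∀ {m n} → n ≤ m → (m <ᵇ n) ≡ false
≥⇒<ᵇ≡false n≤m = ¬-not (λ m<ᵇn → <⇒≱ (<ᵇ⇒< _ _ (Equivalence.from T-≡ m<ᵇn)) n≤m)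

<ᵇ≡true⇒< : ∀ {m n} → (m <ᵇ n) ≡ true → m < n
<ᵇ≡true⇒< = <ᵇ⇒< _ _ ∘ Equivalence.from T-≡

≤⇒≤ᵇ≡true : ∀ {m n} → m ≤ n → (m ≤ᵇ n) ≡ true
≤⇒≤ᵇ≡true m≤n = Equivalence.to T-≡ (≤⇒≤ᵇ m≤n)

>⇒≤ᵇ≡false : ∀ {m n} → n < m → (m ≤ᵇ n) ≡ false
>⇒≤ᵇ≡false (s≤s n≤m) = ≥⇒<ᵇ≡false n≤m

≤ᵇ≡true⇒≤ : ∀ {m n} → (m ≤ᵇ n) ≡ true → m ≤ n
≤ᵇ≡true⇒≤ = ≤ᵇ⇒≤ _ _ ∘ Equivalence.from T-≡

∧≡true : ∀ {a b} → (a ∧ b) ≡ true → a ≡ true × b ≡ true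
∧≡true {true} {true} _ = refl , refl

𝟙-∧ : ∀ a b → 𝟙 (a ∧ b) ≡ 𝟙 a * 𝟙 b
𝟙-∧ true  b = sym (+-identityʳ _)
𝟙-∧ false b = refl

𝟙-1≤ᵇ : ∀ k → k ≤ 1 → 𝟙 (1 ≤ᵇ k) ≡ k
𝟙-1≤ᵇ zero          _ = refl
𝟙-1≤ᵇ (suc zero)    _ = refl
𝟙-1≤ᵇ (suc (suc k)) (s≤s ())

#-<ᵇ : ∀ m k → k ≤ m → #[ t < m ] (t <ᵇ k) ≡ k
#-<ᵇ m       zero    _         = #-false m (λ _ _ → refl)
#-<ᵇ (suc m) (suc k) (s≤s k≤m) = cong suc (#-<ᵇ m k k≤m)

within : ℕ → ℕ → ℕ → Bool
within lo len t = (lo ≤ᵇ t) ∧ (t <ᵇ lo + len)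

within⇒ : ∀ {lo len t} → within lo len t ≡ true → lo ≤ t × t < lo + len
within⇒ {lo} {len} {t} lo≤t<lo+len with ∧≡true {lo ≤ᵇ t} lo≤t<lo+len
... | lo≤t , t<lo+len = ≤ᵇ≡true⇒≤ lo≤t , <ᵇ≡true⇒< t<lo+len

below+within : ∀ lo len t → 𝟙 (t <ᵇ lo) + 𝟙 (within lo len t) ≡ 𝟙 (t <ᵇ lo + len)
below+within lo len t with t <? lo
... | yes t<lo
  rewrite <⇒<ᵇ≡true t<lo | >⇒≤ᵇ≡false t<lo | <⇒<ᵇ≡true (<-≤-trans t<lo (m≤m+n lo len)) = refl
... | no  t≮lo
  rewrite ≥⇒<ᵇ≡false (≮⇒≥ t≮lo) | ≤⇒≤ᵇ≡true (≮⇒≥ t≮lo) = refl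

#-within : ∀ m lo len → lo + len ≤ m → #[ t < m ] within lo len t ≡ len
#-within m lo len lo+len≤m = +-cancelˡ-≡ lo _ _ (begin
  lo + #[ t < m ] within lo len t                         ≡⟨ cong (_+ #[ t < m ] within lo len t) (sym (#-<ᵇ m lo (≤-trans (m≤m+n lo len) lo+len≤m))) ⟩
  #[ t < m ] (t <ᵇ lo) + #[ t < m ] within lo len t       ≡⟨ sym (∑-distrib-+ m _ _) ⟩
  ∑[ t < m ] (𝟙 (t <ᵇ lo) + 𝟙 (within lo len t))          ≡⟨ ∑-cong m (λ t _ → below+within lo len t) ⟩
  #[ t < m ] (t <ᵇ lo + len)                              ≡⟨ #-<ᵇ m (lo + len) lo+len≤m ⟩
  lo + len                                                ∎)
  where open ≡-Reasoning

∑-within-consecutive : ∀ (c : ℕ → ℕ) n t → ∑[ u < n ] 𝟙 (within (∑ u c) (c u) t) ≡ 𝟙 (t <ᵇ ∑ n c)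
∑-within-consecutive c zero    t = refl
∑-within-consecutive c (suc n) t = begin
  ∑[ u < suc n ] 𝟙 (within (∑ u c) (c u) t)                   ≡⟨ ∑-suc n _ ⟩
  ∑[ u < n ] 𝟙 (within (∑ u c) (c u) t) + 𝟙 (within (∑ n c) (c n) t)
                                                              ≡⟨ cong (_+ 𝟙 (within (∑ n c) (c n) t)) (∑-within-consecutive c n t) ⟩
  𝟙 (t <ᵇ ∑ n c) + 𝟙 (within (∑ n c) (c n) t)                 ≡⟨ below+within (∑ n c) (c n) t ⟩
  𝟙 (t <ᵇ ∑ n c + c n)                                        ≡⟨ cong (λ z → 𝟙 (t <ᵇ z)) (sym (∑-suc n c)) ⟩
  𝟙 (t <ᵇ ∑ (suc n) c)                                        ∎
  where open ≡-Reasoning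

-- Realising two degree sequences by a simple bipartite graph

close-quotient-remainder :
  ∀ D ρ j ρ' j' → ρ < D → ρ' < D →
  ρ + j * D < ρ' + j' * D → ρ' + j' * D < ρ + j * D + D →
  (j' ≡ j × ρ < ρ') ⊎ (j' ≡ suc j × ρ' < ρ)
close-quotient-remainder D ρ j ρ' j' ρ<D ρ'<D x<x' x'<x+D with <-cmp j j'
... | tri≈ _ refl _ = inj₁ (refl , +-cancelʳ-< (j * D) ρ ρ' x<x')
... | tri> _ _ j'<j = ⊥-elim (<-asym x<x' (begin-strict
  ρ' + j' * D  <⟨ +-monoˡ-< (j' * D) ρ'<D ⟩
  D + j' * D   ≤⟨ *-monoˡ-≤ D j'<j ⟩
  j * D        ≤⟨ m≤n+m (j * D) ρ ⟩
  ρ + j * D    ∎))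
  where open ≤-Reasoning
... | tri< j<j' _ _ with <-cmp j' (suc j)
...   | tri< j'<1+j _ _ = ⊥-elim (<-irrefl refl (<-≤-trans j<j' (s≤s⁻¹ j'<1+j)))
...   | tri≈ _ refl _ = inj₂ (refl , +-cancelʳ-< (j * D + D) ρ' ρ
          (subst₂ _<_ (move ρ' j D) (+-assoc ρ (j * D) D) x'<x+D))
  where
  move : ∀ r j D → r + (D + j * D) ≡ r + (j * D + D)
  move = solve-∀
...   | tri> _ _ 1+j<j' = ⊥-elim (<-asym x'<x+D (begin-strict
  ρ + j * D + D     ≡⟨ regroup ρ (j * D) D ⟩
  ρ + D + j * D     <⟨ +-monoˡ-< (j * D) (+-monoˡ-< D ρ<D) ⟩
  D + D + j * D     ≡⟨ twice D j ⟩
  suc (suc j) * D   ≤⟨ *-monoˡ-≤ D 1+j<j' ⟩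
  j' * D            ≤⟨ m≤n+m (j' * D) ρ' ⟩
  ρ' + j' * D       ∎))
  where
  open ≤-Reasoning
  regroup : ∀ a b c → a + b + c ≡ a + c + b
  regroup = solve-∀
  twice : ∀ D j → D + D + j * D ≡ suc (suc j) * D
  twice = solve-∀

below-quotient-remainder : ∀ D Q R ρ j → ρ < D → R < D → ρ + j * D < R + Q * D →
                           j < Q ⊎ (j ≡ Q × ρ < R)
below-quotient-remainder D Q R ρ j ρ<D R<D x<m with <-cmp j Q
... | tri< j<Q _ _ = inj₁ j<Q
... | tri≈ _ refl _ = inj₂ (refl , +-cancelʳ-< (j * D) ρ R x<m)
... | tri> _ _ Q<j = ⊥-elim (<-asym x<m (begin-strict
  R + Q * D  <⟨ +-monoˡ-< (Q * D) R<D ⟩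
  D + Q * D  ≤⟨ *-monoˡ-≤ D Q<j ⟩
  j * D      ≤⟨ m≤n+m (j * D) ρ ⟩
  ρ + j * D  ∎))
  where open ≤-Reasoning

-- With m = R + Q·(d+1) and Q ≥ d+1, write x < m as ρ + j·(d+1) with ρ ≤ d.  The
-- residue class ρ has Q or Q+1 elements, and τ lists the classes one after the
-- other in decreasing order of ρ.  Two points less than d+1 apart either have the
-- same quotient and different residues, or the later one has the next quotient
-- and a smaller residue; either way τ puts them at least Q ≥ d+1 apart.
module Spreading (d Q R : ℕ) (1+d≤Q : suc d ≤ Q) (R<1+d : R < suc d) where

  classStart : ℕ → ℕ
  classStart ρ = (d ∸ ρ) * Q + (R ∸ suc ρ)

  cell : ℕ → ℕ → ℕ
  cell ρ j = classStart ρ + j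

  private
    regroup : ∀ a b c → a + b + c ≡ a + c + b
    regroup = solve-∀

    Q-gap : ∀ {ρ ρ'} → ρ < ρ' → ρ' ≤ d → (d ∸ ρ') * Q + Q ≤ (d ∸ ρ) * Q
    Q-gap {ρ} {ρ'} ρ<ρ' ρ'≤d = subst (_≤ (d ∸ ρ) * Q) (+-comm Q _) (*-monoˡ-≤ Q
      (subst (_≤ d ∸ ρ) (+-∸-assoc 1 ρ'≤d) (∸-monoʳ-≤ (suc d) ρ<ρ')))

  classStart-gap : ∀ {ρ ρ'} → ρ < ρ' → ρ' ≤ d → classStart ρ' + Q ≤ classStart ρ
  classStart-gap {ρ} {ρ'} ρ<ρ' ρ'≤d = begin
    (d ∸ ρ') * Q + (R ∸ suc ρ') + Q  ≡⟨ regroup ((d ∸ ρ') * Q) (R ∸ suc ρ') Q ⟩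
    (d ∸ ρ') * Q + Q + (R ∸ suc ρ')  ≤⟨ +-mono-≤ (Q-gap ρ<ρ' ρ'≤d) (∸-monoʳ-≤ R (s≤s (<⇒≤ ρ<ρ'))) ⟩
    (d ∸ ρ) * Q + (R ∸ suc ρ)        ∎
    where open ≤-Reasoning

  classStart-gap-< : ∀ {ρ ρ'} → ρ < ρ' → ρ' ≤ d → ρ' < R → classStart ρ' + Q < classStart ρ
  classStart-gap-< {ρ} {ρ'} ρ<ρ' ρ'≤d ρ'<R = begin-strict
    (d ∸ ρ') * Q + (R ∸ suc ρ') + Q  ≡⟨ regroup ((d ∸ ρ') * Q) (R ∸ suc ρ') Q ⟩
    (d ∸ ρ') * Q + Q + (R ∸ suc ρ')  <⟨ +-mono-≤-< (Q-gap ρ<ρ' ρ'≤d)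
                                          (subst (_≤ R ∸ suc ρ) (+-∸-assoc 1 ρ'<R) (∸-monoʳ-≤ R ρ<ρ')) ⟩
    (d ∸ ρ) * Q + (R ∸ suc ρ)        ∎
    where open ≤-Reasoning

  block-end : ∀ ρ → (d ∸ ρ) * Q + R + Q ≤ R + Q * suc d
  block-end ρ = begin
    (d ∸ ρ) * Q + R + Q  ≤⟨ +-monoˡ-≤ Q (+-monoˡ-≤ R (*-monoˡ-≤ Q (m∸n≤m d ρ))) ⟩
    d * Q + R + Q        ≡⟨ rearrange d Q R ⟩
    R + Q * suc d        ∎
    where
    open ≤-Reasoning
    rearrange : ∀ d Q R → d * Q + R + Q ≡ R + Q * suc d
    rearrange = solve-∀

  cell-separated : ∀ ρ j ρ' j' → ρ < suc d → ρ' < suc d →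
                   ρ + j * suc d < ρ' + j' * suc d → ρ' + j' * suc d < ρ + j * suc d + suc d →
                   cell ρ' j' + suc d ≤ cell ρ j ⊎ cell ρ j + suc d ≤ cell ρ' j'
  cell-separated ρ j ρ' j' ρ<D ρ'<D x<x' x'<x+D
    with close-quotient-remainder (suc d) ρ j ρ' j' ρ<D ρ'<D x<x' x'<x+D
  ... | inj₁ (refl , ρ<ρ') = inj₁ (begin
    classStart ρ' + j + suc d  ≤⟨ +-monoʳ-≤ (classStart ρ' + j) 1+d≤Q ⟩
    classStart ρ' + j + Q      ≡⟨ regroup (classStart ρ') j Q ⟩
    classStart ρ' + Q + j      ≤⟨ +-monoˡ-≤ j (classStart-gap ρ<ρ' (s≤s⁻¹ ρ'<D)) ⟩
    classStart ρ + j           ∎)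
    where open ≤-Reasoning
  ... | inj₂ (refl , ρ'<ρ) = inj₂ (begin
    classStart ρ + j + suc d   ≤⟨ +-monoʳ-≤ (classStart ρ + j) 1+d≤Q ⟩
    classStart ρ + j + Q       ≡⟨ regroup (classStart ρ) j Q ⟩
    classStart ρ + Q + j       ≤⟨ +-monoˡ-≤ j (classStart-gap ρ'<ρ (s≤s⁻¹ ρ<D)) ⟩
    classStart ρ' + j          ≤⟨ +-monoʳ-≤ (classStart ρ') (n≤1+n j) ⟩
    classStart ρ' + suc j      ∎)
    where open ≤-Reasoning

  cell-< : ∀ ρ j → ρ < suc d → ρ + j * suc d < R + Q * suc d → cell ρ j < R + Q * suc d
  cell-< ρ j ρ<D x<m with below-quotient-remainder (suc d) Q R ρ j ρ<D R<1+d x<m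
  ... | inj₁ j<Q = begin-strict
    classStart ρ + j                       <⟨ +-monoʳ-< (classStart ρ) j<Q ⟩
    classStart ρ + Q                       ≤⟨ +-monoˡ-≤ Q (+-monoʳ-≤ ((d ∸ ρ) * Q) (m∸n≤m R (suc ρ))) ⟩
    (d ∸ ρ) * Q + R + Q               ≤⟨ block-end ρ ⟩
    R + Q * suc d                     ∎
    where open ≤-Reasoning
  ... | inj₂ (refl , ρ<R) = begin-strict
    classStart ρ + Q                       <⟨ +-monoˡ-< Q (+-monoʳ-< ((d ∸ ρ) * Q)
                                           (subst (_≤ R) (+-∸-assoc 1 ρ<R) (m∸n≤m R ρ))) ⟩
    (d ∸ ρ) * Q + R + Q               ≤⟨ block-end ρ ⟩
    R + Q * suc d                     ∎
    where open ≤-Reasoning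

  cell-decreasing : ∀ ρ j ρ' j' → ρ < ρ' → ρ' < suc d → ρ' + j' * suc d < R + Q * suc d →
                    cell ρ' j' < cell ρ j
  cell-decreasing ρ j ρ' j' ρ<ρ' ρ'<D x'<m
    with below-quotient-remainder (suc d) Q R ρ' j' ρ'<D R<1+d x'<m
  ... | inj₁ j'<Q = <-≤-trans (+-monoʳ-< (classStart ρ') j'<Q)
                      (≤-trans (classStart-gap ρ<ρ' (s≤s⁻¹ ρ'<D)) (m≤m+n (classStart ρ) j))
  ... | inj₂ (refl , ρ'<R) = <-≤-trans (classStart-gap-< ρ<ρ' (s≤s⁻¹ ρ'<D) ρ'<R) (m≤m+n (classStart ρ) j)

  cell-injective : ∀ ρ j ρ' j' → ρ < suc d → ρ' < suc d →
                   ρ + j * suc d < R + Q * suc d → ρ' + j' * suc d < R + Q * suc d →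
                   cell ρ j ≡ cell ρ' j' → ρ + j * suc d ≡ ρ' + j' * suc d
  cell-injective ρ j ρ' j' ρ<D ρ'<D x<m x'<m τx≡τx' with <-cmp ρ ρ'
  ... | tri< ρ<ρ' _ _ = ⊥-elim (<-irrefl (sym τx≡τx') (cell-decreasing ρ j ρ' j' ρ<ρ' ρ'<D x'<m))
  ... | tri> _ _ ρ'<ρ = ⊥-elim (<-irrefl τx≡τx' (cell-decreasing ρ' j' ρ j ρ'<ρ ρ<D x<m))
  ... | tri≈ _ refl _ = cong (λ j → ρ + j * suc d) (+-cancelˡ-≡ (classStart ρ) j j' τx≡τx')

spreading-map : ∀ d m → suc d * suc d ≤ m → Σ (ℕ → ℕ) λ τ →
  (∀ x → x < m → τ x < m) ×
  (∀ x x' → x < m → x' < m → τ x ≡ τ x' → x ≡ x') ×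
  (∀ x x' → x < x' → x' < x + suc d → τ x' + suc d ≤ τ x ⊎ τ x + suc d ≤ τ x')
spreading-map d m D²≤m = τ , τ-< , τ-injective , τ-separated
  where
  D = suc d
  Q = m / D
  R = m % D

  m≡ : m ≡ R + Q * D
  m≡ = m≡m%n+[m/n]*n m D

  D≤Q : D ≤ Q
  D≤Q = s≤s⁻¹ (*-cancelʳ-< D D (suc Q) (begin-strict
    D * D      ≤⟨ D²≤m ⟩
    m          ≡⟨ m≡ ⟩
    R + Q * D  <⟨ +-monoˡ-< (Q * D) (m%n<n m D) ⟩
    D + Q * D  ∎))
    where open ≤-Reasoning

  open Spreading d Q R D≤Q (m%n<n m D)

  τ : ℕ → ℕ
  τ x = cell (x % D) (x / D)

  x≡ : ∀ x → x ≡ x % D + x / D * D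
  x≡ x = m≡m%n+[m/n]*n x D

  τ-< : ∀ x → x < m → τ x < m
  τ-< x x<m = subst (τ x <_) (sym m≡)
    (cell-< (x % D) (x / D) (m%n<n x D) (subst₂ _<_ (x≡ x) m≡ x<m))

  τ-injective : ∀ x x' → x < m → x' < m → τ x ≡ τ x' → x ≡ x'
  τ-injective x x' x<m x'<m τx≡τx' = trans (x≡ x) (trans
    (cell-injective (x % D) (x / D) (x' % D) (x' / D) (m%n<n x D) (m%n<n x' D)
      (subst₂ _<_ (x≡ x) m≡ x<m) (subst₂ _<_ (x≡ x') m≡ x'<m) τx≡τx')
    (sym (x≡ x')))

  τ-separated : ∀ x x' → x < x' → x' < x + D → τ x' + D ≤ τ x ⊎ τ x + D ≤ τ x'
  τ-separated x x' x<x' x'<x+D = cell-separated (x % D) (x / D) (x' % D) (x' / D) (m%n<n x D) (m%n<n x' D)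
    (subst₂ _<_ (x≡ x) (x≡ x') x<x') (subst₂ _<_ (x≡ x') (cong (_+ D) (x≡ x)) x'<x+D)

-- Cut [0, m) into consecutive intervals I_u of lengths c u and, independently,
-- into consecutive intervals J_y of lengths r y; join u to y when τ maps a point
-- of J_y into I_u.  Two points of J_y are closer than d+1, so their images are
-- at least d+1 apart and cannot both lie in I_u: each edge is witnessed by
-- exactly one point, and counting points gives both degree sequences.
module Incidence (d n s : ℕ) (c r : ℕ → ℕ)
                 (c≤ : ∀ u → u < n → c u ≤ suc d) (r≤ : ∀ y → y < s → r y ≤ suc d)
                 (∑c≡∑r : ∑ n c ≡ ∑ s r) (D²≤∑c : suc d * suc d ≤ ∑ n c) where

  m : ℕ
  m = ∑ n c

  τ : ℕ → ℕ
  τ = proj₁ (spreading-map d m D²≤∑c)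

  τ-< : ∀ x → x < m → τ x < m
  τ-< = proj₁ (proj₂ (spreading-map d m D²≤∑c))

  τ-injective : ∀ x x' → x < m → x' < m → τ x ≡ τ x' → x ≡ x'
  τ-injective = proj₁ (proj₂ (proj₂ (spreading-map d m D²≤∑c)))

  τ-separated : ∀ x x' → x < x' → x' < x + suc d → τ x' + suc d ≤ τ x ⊎ τ x + suc d ≤ τ x'
  τ-separated = proj₂ (proj₂ (proj₂ (spreading-map d m D²≤∑c)))

  inI : ℕ → ℕ → Bool
  inI u = within (∑ u c) (c u)

  inJ : ℕ → ℕ → Bool
  inJ y = within (∑ y r) (r y)

  hits : ℕ → ℕ → ℕ → Bool
  hits u y x = inJ y x ∧ inI u (τ x)

  edge : ℕ → ℕ → Bool
  edge u y = 1 ≤ᵇ #[ x < m ] hits u y x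

  private
    close : ∀ {lo len t t' D} → lo ≤ t → t' < lo + len → len ≤ D → t' < t + D
    close lo≤t t'<lo+len len≤D = <-≤-trans t'<lo+len (+-mono-≤ lo≤t len≤D)

  hits-≤1 : ∀ u y → u < n → y < s → #[ x < m ] hits u y x ≤ 1
  hits-≤1 u y u<n y<s = #≤1 m (hits u y) unique
    where
    no-two : ∀ x x' → x < x' → hits u y x ≡ true → hits u y x' ≡ true → ⊥
    no-two x x' x<x' hx hx' with ∧≡true {inJ y x} hx | ∧≡true {inJ y x'} hx'
    ... | Jx , Iτx | Jx' , Iτx' with within⇒ {∑ y r} Jx | within⇒ {∑ y r} Jx'
                                    | within⇒ {∑ u c} Iτx | within⇒ {∑ u c} Iτx'
    ... | Jx₁ , _ | _ , Jx'₂ | Iτx₁ , Iτx₂ | Iτx'₁ , Iτx'₂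
      with τ-separated x x' x<x' (close Jx₁ Jx'₂ (r≤ y y<s))
    ... | inj₁ τx'+D≤τx = <-irrefl refl (<-≤-trans (close Iτx'₁ Iτx₂ (c≤ u u<n)) τx'+D≤τx)
    ... | inj₂ τx+D≤τx' = <-irrefl refl (<-≤-trans (close Iτx₁ Iτx'₂ (c≤ u u<n)) τx+D≤τx')
    unique : ∀ x x' → x < m → x' < m → hits u y x ≡ true → hits u y x' ≡ true → x ≡ x'
    unique x x' _ _ hx hx' with <-cmp x x'
    ... | tri< x<x' _ _ = ⊥-elim (no-two x x' x<x' hx hx')
    ... | tri≈ _ x≡x' _ = x≡x'
    ... | tri> _ _ x'<x = ⊥-elim (no-two x' x x'<x hx' hx)

  𝟙-edge : ∀ u y → u < n → y < s → 𝟙 (edge u y) ≡ #[ x < m ] hits u y x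
  𝟙-edge u y u<n y<s = 𝟙-1≤ᵇ _ (hits-≤1 u y u<n y<s)

  inI-once : ∀ x → x < m → ∑[ u < n ] 𝟙 (inI u (τ x)) ≡ 1
  inI-once x x<m = trans (∑-within-consecutive c n (τ x)) (cong 𝟙 (<⇒<ᵇ≡true (τ-< x x<m)))

  inJ-once : ∀ x → x < m → ∑[ y < s ] 𝟙 (inJ y x) ≡ 1
  inJ-once x x<m = trans (∑-within-consecutive r s x) (cong 𝟙 (<⇒<ᵇ≡true (subst (x <_) ∑c≡∑r x<m)))

  indegree : ∀ y → y < s → #[ u < n ] edge u y ≡ r y
  indegree y y<s = begin
    #[ u < n ] edge u y                                        ≡⟨ ∑-cong n (λ u u<n → 𝟙-edge u y u<n y<s) ⟩
    ∑[ u < n ] #[ x < m ] hits u y x                           ≡⟨ ∑-comm n m _ ⟩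
    ∑[ x < m ] ∑[ u < n ] 𝟙 (inJ y x ∧ inI u (τ x))         ≡⟨ ∑-cong m (λ x _ → ∑-cong n (λ u _ → 𝟙-∧ (inJ y x) _)) ⟩
    ∑[ x < m ] ∑[ u < n ] (𝟙 (inJ y x) * 𝟙 (inI u (τ x)))  ≡⟨ ∑-cong m (λ x _ → ∑-*ˡ n (𝟙 (inJ y x)) _) ⟩
    ∑[ x < m ] (𝟙 (inJ y x) * ∑[ u < n ] 𝟙 (inI u (τ x)))  ≡⟨ ∑-cong m (λ x x<m → trans (cong (𝟙 (inJ y x) *_) (inI-once x x<m)) (*-identityʳ _)) ⟩
    #[ x < m ] inJ y x                                       ≡⟨ #-within m (∑ y r) (r y) (subst (∑ y r + r y ≤_) (sym ∑c≡∑r) (∑-suc-≤ r y<s)) ⟩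
    r y                                                        ∎
    where open ≡-Reasoning

  preimage-≤ : ∀ u → u < n → #[ x < m ] inI u (τ x) ≤ c u
  preimage-≤ u u<n = ≤-trans (∑-reindex-≤ m m τ τ-< τ-injective (𝟙 ∘ inI u))
    (≤-reflexive (#-within m (∑ u c) (c u) (∑-suc-≤ c u<n)))

  preimage-≡ : ∀ u → u < n → #[ x < m ] inI u (τ x) ≡ c u
  preimage-≡ = ∑-mono-≤-≡⇒≡ n preimage-≤ (begin
    ∑[ u < n ] #[ x < m ] inI u (τ x)     ≡⟨ ∑-comm n m _ ⟩
    ∑[ x < m ] ∑[ u < n ] 𝟙 (inI u (τ x)) ≡⟨ ∑-cong m (λ x x<m → trans (inI-once x x<m) (cong 𝟙 (sym (<⇒<ᵇ≡true x<m)))) ⟩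
    #[ x < m ] (x <ᵇ m)                    ≡⟨ #-<ᵇ m m ≤-refl ⟩
    m                                      ∎)
    where open ≡-Reasoning

  outdegree : ∀ u → u < n → #[ y < s ] edge u y ≡ c u
  outdegree u u<n = begin
    #[ y < s ] edge u y                                        ≡⟨ ∑-cong s (λ y y<s → 𝟙-edge u y u<n y<s) ⟩
    ∑[ y < s ] #[ x < m ] hits u y x                           ≡⟨ ∑-comm s m _ ⟩
    ∑[ x < m ] ∑[ y < s ] 𝟙 (inJ y x ∧ inI u (τ x))         ≡⟨ ∑-cong m (λ x _ → ∑-cong s (λ y _ → trans (𝟙-∧ (inJ y x) _) (*-comm (𝟙 (inJ y x)) _))) ⟩
    ∑[ x < m ] ∑[ y < s ] (𝟙 (inI u (τ x)) * 𝟙 (inJ y x))  ≡⟨ ∑-cong m (λ x _ → ∑-*ˡ s (𝟙 (inI u (τ x))) _) ⟩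
    ∑[ x < m ] (𝟙 (inI u (τ x)) * ∑[ y < s ] 𝟙 (inJ y x))  ≡⟨ ∑-cong m (λ x x<m → trans (cong (𝟙 (inI u (τ x)) *_) (inJ-once x x<m)) (*-identityʳ _)) ⟩
    #[ x < m ] inI u (τ x)                                    ≡⟨ preimage-≡ u u<n ⟩
    c u                                                        ∎
    where open ≡-Reasoning

bipartite-realization :
  ∀ d n s (c r : ℕ → ℕ) → (∀ u → u < n → c u ≤ suc d) → (∀ y → y < s → r y ≤ suc d) →
  ∑ n c ≡ ∑ s r → suc d * suc d ≤ ∑ n c →
  Σ (ℕ → ℕ → Bool) λ B → (∀ u → u < n → #[ y < s ] B u y ≡ c u) × (∀ y → y < s → #[ u < n ] B u y ≡ r y)
bipartite-realization d n s c r c≤ r≤ ∑c≡∑r D²≤∑c = edge , outdegree , indegree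
  where open Incidence d n s c r c≤ r≤ ∑c≡∑r D²≤∑c

-- Dags with vertices in ℕ

sum-tabulate : ∀ {n} (F : Fin n → ℕ) (f : ℕ → ℕ) → (∀ k → f (toℕ k) ≡ F k) → sum (tabulate F) ≡ ∑ n f
sum-tabulate {zero}  F f f≡F = refl
sum-tabulate {suc n} F f f≡F = cong₂ _+_ (sym (f≡F fzero)) (sum-tabulate (F ∘ fsuc) (f ∘ suc) (f≡F ∘ fsuc))

countFin-# : ∀ {n} (P : Fin n → Bool) (Q : ℕ → Bool) → (∀ k → Q (toℕ k) ≡ P k) → countFin P ≡ # n Q
countFin-# {n} P Q Q≡P = trans (cong sum (map-tabulate (λ k → k) (𝟙 ∘ P)))
  (sum-tabulate (𝟙 ∘ P) (𝟙 ∘ Q) (cong 𝟙 ∘ Q≡P))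

Graph : Set
Graph = ℕ → ℕ → Bool

Forwardℕ : Graph → Set
Forwardℕ E = ∀ u v → E u v ≡ true → u < v

forward-false : ∀ {E} → Forwardℕ E → ∀ {u v} → v ≤ u → E u v ≡ false
forward-false F {u} {v} v≤u = ¬-not (λ Euv → <⇒≱ (F u v Euv) v≤u)

-- Out-of-range positions read as (0 , 0).
at : List Deg → ℕ → Deg
at []       _       = 0 , 0
at (x ∷ xs) zero    = x
at (x ∷ xs) (suc k) = at xs k

lookup-at : ∀ (xs : List Deg) k → lookup xs k ≡ at xs (toℕ k)
lookup-at (x ∷ xs) fzero    = refl
lookup-at (x ∷ xs) (fsuc k) = lookup-at xs k

at-++ˡ : ∀ (xs ys : List Deg) {k} → k < length xs → at (xs ++ ys) k ≡ at xs k
at-++ˡ (x ∷ xs) ys {zero}  _         = refl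
at-++ˡ (x ∷ xs) ys {suc k} (s<s k<n) = at-++ˡ xs ys k<n

at-++ʳ : ∀ (xs ys : List Deg) k → at (xs ++ ys) (length xs + k) ≡ at ys k
at-++ʳ []       ys k = refl
at-++ʳ (x ∷ xs) ys k = at-++ʳ xs ys k

at-drop : ∀ (xs : List Deg) i k → at (drop i xs) k ≡ at xs (i + k)
at-drop xs       zero    k = refl
at-drop []       (suc i) k = refl
at-drop (x ∷ xs) (suc i) k = at-drop xs i k

at-bounded : ∀ {Δ} (xs : List Deg) → Bounded Δ xs → ∀ {k} → k < length xs →
             proj₁ (at xs k) ≤ Δ × proj₂ (at xs k) ≤ Δ
at-bounded (x ∷ xs) (x≤ ∷ _)   {zero}  _         = x≤
at-bounded (x ∷ xs) (_ ∷ xs≤)  {suc k} (s<s k<n) = at-bounded xs xs≤ k<n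

+-length-drop : ∀ (xs : List Deg) {i} → i ≤ length xs → i + length (drop i xs) ≡ length xs
+-length-drop xs {i} i≤n = trans (cong (i +_) (length-drop i xs)) (m+[n∸m]≡n i≤n)

RealizesInOrderℕ : List Deg → Graph → Set
RealizesInOrderℕ ψ E =
  Forwardℕ E ×
  (∀ k → k < length ψ →
     #[ u < length ψ ] E u k ≡ proj₁ (at ψ k) × #[ v < length ψ ] E k v ≡ proj₂ (at ψ k))

-- Vertices are transported from Fin n to ℕ (no arcs outside the range), so that
-- a vertex sequence can be split and shifted by arithmetic on positions.
extend : ∀ n → (Fin n → Bool) → ℕ → Bool
extend n P u with u <? n
... | yes u<n = P (fromℕ< u<n)
... | no  _   = false

extend-toℕ : ∀ {n} (P : Fin n → Bool) k → extend n P (toℕ k) ≡ P k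
extend-toℕ {n} P k with toℕ k <? n
... | yes k<n = cong P (fromℕ<-toℕ k k<n)
... | no  k≮n = ⊥-elim (k≮n (toℕ<n k))

extend-true : ∀ {n} (P : Fin n → Bool) u → extend n P u ≡ true → Σ (Fin n) λ k → toℕ k ≡ u × P k ≡ true
extend-true {n} P u Pu with u <? n
... | yes u<n = fromℕ< u<n , toℕ-fromℕ< u<n , Pu

lift : ∀ {n} → Adj n → Graph
lift {n} A u v = extend n (λ k → extend n (A k) v) u

lift-toℕ : ∀ {n} (A : Adj n) k l → lift A (toℕ k) (toℕ l) ≡ A k l
lift-toℕ {n} A k l = trans (extend-toℕ (λ k → extend n (A k) (toℕ l)) k) (extend-toℕ (A k) l)

lift-true : ∀ {n} (A : Adj n) u v → lift A u v ≡ true →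
            Σ (Fin n) λ k → Σ (Fin n) λ l → toℕ k ≡ u × toℕ l ≡ v × A k l ≡ true
lift-true {n} A u v Auv with extend-true _ u Auv
... | k , k≡u , Akv with extend-true (A k) v Akv
...   | l , l≡v , Akl = k , l , k≡u , l≡v , Akl

lift-forward : ∀ {n} (A : Adj n) → Forward A → Forwardℕ (lift A)
lift-forward A F u v Auv with lift-true A u v Auv
... | k , l , refl , refl , Akl = F k l Akl

lift-realizes : ∀ {ψ} {A : Adj (length ψ)} → RealizesInOrder ψ A → RealizesInOrderℕ ψ (lift A)
lift-realizes {ψ} {A} (F , deg) = lift-forward A F , deg′
  where
  deg′ : ∀ k → k < length ψ →
         #[ u < length ψ ] lift A u k ≡ proj₁ (at ψ k) × #[ v < length ψ ] lift A k v ≡ proj₂ (at ψ k)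
  deg′ k k<n with fromℕ< k<n | toℕ-fromℕ< k<n | deg (fromℕ< k<n)
  ... | k′ | refl | in≡ , out≡ =
    trans (sym (countFin-# _ _ (λ u → lift-toℕ A u k′))) (trans in≡ (cong proj₁ (lookup-at ψ k′))) ,
    trans (sym (countFin-# _ _ (λ v → lift-toℕ A k′ v))) (trans out≡ (cong proj₂ (lookup-at ψ k′)))

restrict-realizes : ∀ {ψ} → Σ Graph (RealizesInOrderℕ ψ) → Σ (Adj (length ψ)) (RealizesInOrder ψ)
restrict-realizes {ψ} (E , F , deg) = (λ k l → E (toℕ k) (toℕ l)) , (λ k l → F (toℕ k) (toℕ l)) , deg′
  where
  deg′ : ∀ k → indeg (λ k l → E (toℕ k) (toℕ l)) k ≡ proj₁ (lookup ψ k) ×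
               outdeg (λ k l → E (toℕ k) (toℕ l)) k ≡ proj₂ (lookup ψ k)
  deg′ k with deg (toℕ k) (toℕ<n k)
  ... | in≡ , out≡ =
    trans (countFin-# {length ψ} _ (λ u → E u (toℕ k)) (λ _ → refl)) (trans in≡ (cong proj₁ (sym (lookup-at ψ k)))) ,
    trans (countFin-# {length ψ} _ (E (toℕ k)) (λ _ → refl)) (trans out≡ (cong proj₂ (sym (lookup-at ψ k))))

#-in-prefix : ∀ {E} → Forwardℕ E → ∀ a b {v} → v ≤ a → #[ u < a + b ] E u v ≡ #[ u < a ] E u v
#-in-prefix {E} F a b {v} v≤a = begin
  #[ u < a + b ] E u v                            ≡⟨ ∑-+ a b _ ⟩
  #[ u < a ] E u v + #[ x < b ] E (a + x) v       ≡⟨ cong (#[ u < a ] E u v +_) (#-false b (λ x _ → forward-false F (≤-trans v≤a (m≤m+n a x)))) ⟩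
  #[ u < a ] E u v + 0                            ≡⟨ +-identityʳ _ ⟩
  #[ u < a ] E u v                                ∎
  where open ≡-Reasoning

#-out-suffix : ∀ {E} → Forwardℕ E → ∀ a b y → #[ v < a + b ] E (a + y) v ≡ #[ x < b ] E (a + y) (a + x)
#-out-suffix {E} F a b y = begin
  #[ v < a + b ] E (a + y) v                              ≡⟨ ∑-+ a b _ ⟩
  #[ v < a ] E (a + y) v + #[ x < b ] E (a + y) (a + x)   ≡⟨ cong (_+ #[ x < b ] E (a + y) (a + x)) (#-false a (λ v v<a → forward-false F (≤-trans (<⇒≤ v<a) (m≤m+n a y)))) ⟩
  #[ x < b ] E (a + y) (a + x)                            ∎
  where open ≡-Reasoning

++-prefix-degrees :
  ∀ ψ₁ ψ₂ {E} → RealizesInOrderℕ (ψ₁ ++ ψ₂) E → ∀ u → u < length ψ₁ →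
  #[ v < length ψ₁ ] E v u ≡ proj₁ (at ψ₁ u) ×
  #[ v < length ψ₁ ] E u v + #[ w < length ψ₂ ] E u (length ψ₁ + w) ≡ proj₂ (at ψ₁ u)
++-prefix-degrees ψ₁ ψ₂ {E} (F , deg) u u<n₁
  with deg u (<-≤-trans u<n₁ (≤-trans (m≤m+n _ _) (≤-reflexive (sym (length-++ ψ₁)))))
... | in≡ , out≡ = in-prefix , out-prefix
  where
  open ≡-Reasoning
  n₁ = length ψ₁
  n₂ = length ψ₂
  in-prefix : #[ v < n₁ ] E v u ≡ proj₁ (at ψ₁ u)
  in-prefix = begin
    #[ v < n₁ ] E v u                  ≡⟨ sym (#-in-prefix F n₁ n₂ (<⇒≤ u<n₁)) ⟩
    #[ v < n₁ + n₂ ] E v u             ≡⟨ cong (λ L → #[ v < L ] E v u) (sym (length-++ ψ₁)) ⟩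
    #[ v < length (ψ₁ ++ ψ₂) ] E v u   ≡⟨ in≡ ⟩
    proj₁ (at (ψ₁ ++ ψ₂) u)            ≡⟨ cong proj₁ (at-++ˡ ψ₁ ψ₂ u<n₁) ⟩
    proj₁ (at ψ₁ u)                    ∎
  out-prefix : #[ v < n₁ ] E u v + #[ w < n₂ ] E u (n₁ + w) ≡ proj₂ (at ψ₁ u)
  out-prefix = begin
    #[ v < n₁ ] E u v + #[ w < n₂ ] E u (n₁ + w)  ≡⟨ sym (∑-+ n₁ n₂ _) ⟩
    #[ v < n₁ + n₂ ] E u v                        ≡⟨ cong (λ L → #[ v < L ] E u v) (sym (length-++ ψ₁)) ⟩
    #[ v < length (ψ₁ ++ ψ₂) ] E u v              ≡⟨ out≡ ⟩
    proj₂ (at (ψ₁ ++ ψ₂) u)                       ≡⟨ cong proj₂ (at-++ˡ ψ₁ ψ₂ u<n₁) ⟩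
    proj₂ (at ψ₁ u)                               ∎

drop-degrees :
  ∀ ψ {E} i → i ≤ length ψ → RealizesInOrderℕ ψ E → ∀ y → y < length (drop i ψ) →
  #[ k < i ] E k (i + y) + #[ x < length (drop i ψ) ] E (i + x) (i + y) ≡ proj₁ (at (drop i ψ) y) ×
  #[ x < length (drop i ψ) ] E (i + y) (i + x) ≡ proj₂ (at (drop i ψ) y)
drop-degrees ψ {E} i i≤n (F , deg) y y<s
  with deg (i + y) (subst (i + y <_) (+-length-drop ψ i≤n) (+-monoʳ-< i y<s))
... | in≡ , out≡ = in-suffix , out-suffix
  where
  open ≡-Reasoning
  s = length (drop i ψ)
  in-suffix : #[ k < i ] E k (i + y) + #[ x < s ] E (i + x) (i + y) ≡ proj₁ (at (drop i ψ) y)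
  in-suffix = begin
    #[ k < i ] E k (i + y) + #[ x < s ] E (i + x) (i + y)  ≡⟨ sym (∑-+ i s _) ⟩
    #[ k < i + s ] E k (i + y)                             ≡⟨ cong (λ L → #[ k < L ] E k (i + y)) (+-length-drop ψ i≤n) ⟩
    #[ k < length ψ ] E k (i + y)                          ≡⟨ in≡ ⟩
    proj₁ (at ψ (i + y))                                   ≡⟨ cong proj₁ (sym (at-drop ψ i y)) ⟩
    proj₁ (at (drop i ψ) y)                                ∎
  out-suffix : #[ x < s ] E (i + y) (i + x) ≡ proj₂ (at (drop i ψ) y)
  out-suffix = begin
    #[ x < s ] E (i + y) (i + x)    ≡⟨ sym (#-out-suffix F i s y) ⟩
    #[ v < i + s ] E (i + y) v      ≡⟨ cong (λ L → #[ v < L ] E (i + y) v) (+-length-drop ψ i≤n) ⟩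
    #[ v < length ψ ] E (i + y) v   ≡⟨ out≡ ⟩
    proj₂ (at ψ (i + y))            ≡⟨ cong proj₂ (sym (at-drop ψ i y)) ⟩
    proj₂ (at (drop i ψ) y)         ∎

out-bounded : ∀ {Δ ψ E} → Bounded Δ ψ → RealizesInOrderℕ ψ E → ∀ k → k < length ψ → #[ v < length ψ ] E k v ≤ Δ
out-bounded {ψ = ψ} bounded (_ , deg) k k<n =
  subst (_≤ _) (sym (proj₂ (deg k k<n))) (proj₂ (at-bounded ψ bounded k<n))

toList-tabulate : ∀ {n} (F : Fin n → ℕ) → Vec.toList (Vec.tabulate F) ≡ tabulate F
toList-tabulate {zero}  F = refl
toList-tabulate {suc n} F = cong (F fzero ∷_) (toList-tabulate (F ∘ fsuc))

-- A vertex among the first i with a later neighbours adds 1 to p_i[l] for each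
-- l ≤ a, and in a forward graph its later neighbours are its out-neighbours.
ω-potential : ∀ Δ {n} (G : Adj n) → Forward G → (∀ k → k < n → #[ v < n ] lift G k v ≤ Δ) →
              ∀ i s → i + s ≡ n → ω (potential Δ G i) ≡ ∑[ k < i ] #[ w < s ] lift G k (i + w)
ω-potential Δ G F out≤Δ i s refl = begin
  ω (potential Δ G i)
    ≡⟨ cong sum (toList-tabulate {Δ} _) ⟩
  sum (tabulate {n = Δ} (λ l → countFin (λ k → (toℕ k <ᵇ i) ∧ (toℕ l <ᵇ nbrsAfter G i k))))
    ≡⟨ sum-tabulate {Δ} _ (λ l → #[ k < i + s ] ((k <ᵇ i) ∧ (l <ᵇ after k)))
         (λ l → sym (countFin-# {i + s} _ _ (λ k → cong (λ a → (toℕ k <ᵇ i) ∧ (toℕ l <ᵇ a)) (sym (nbrsAfter≡ k))))) ⟩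
  ∑[ l < Δ ] #[ k < i + s ] ((k <ᵇ i) ∧ (l <ᵇ after k))
    ≡⟨ ∑-comm Δ (i + s) _ ⟩
  ∑[ k < i + s ] #[ l < Δ ] ((k <ᵇ i) ∧ (l <ᵇ after k))
    ≡⟨ ∑-cong (i + s) (λ k _ → trans (∑-cong Δ (λ l _ → 𝟙-∧ (k <ᵇ i) _)) (∑-*ˡ Δ (𝟙 (k <ᵇ i)) _)) ⟩
  ∑[ k < i + s ] (𝟙 (k <ᵇ i) * #[ l < Δ ] (l <ᵇ after k))
    ≡⟨ ∑-+ i s _ ⟩
  ∑[ k < i ] (𝟙 (k <ᵇ i) * #[ l < Δ ] (l <ᵇ after k)) + ∑[ w < s ] (𝟙 (i + w <ᵇ i) * #[ l < Δ ] (l <ᵇ after (i + w)))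
    ≡⟨ cong₂ _+_ (∑-cong i early) (∑-zero s (λ w _ → cong (λ b → 𝟙 b * #[ l < Δ ] (l <ᵇ after (i + w))) (≥⇒<ᵇ≡false (m≤m+n i w)))) ⟩
  ∑[ k < i ] #[ w < s ] lift G k (i + w) + 0
    ≡⟨ +-identityʳ _ ⟩
  ∑[ k < i ] #[ w < s ] lift G k (i + w)  ∎
  where
  open ≡-Reasoning
  after : ℕ → ℕ
  after k = #[ j < i + s ] ((i ≤ᵇ j) ∧ (lift G k j ∨ lift G j k))

  nbrsAfter≡ : ∀ k → nbrsAfter G i k ≡ after (toℕ k)
  nbrsAfter≡ k = countFin-# _ _ (λ j → cong₂ (λ a b → (i ≤ᵇ toℕ j) ∧ (a ∨ b)) (lift-toℕ G k j) (lift-toℕ G j k))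

  after-forward : ∀ {k} → k < i → after k ≡ #[ w < s ] lift G k (i + w)
  after-forward {k} k<i = begin
    after k
      ≡⟨ ∑-+ i s _ ⟩
    #[ j < i ] ((i ≤ᵇ j) ∧ (lift G k j ∨ lift G j k)) + #[ w < s ] ((i ≤ᵇ i + w) ∧ (lift G k (i + w) ∨ lift G (i + w) k))
      ≡⟨ cong₂ _+_ (#-false i (λ j j<i → cong (_∧ (lift G k j ∨ lift G j k)) (>⇒≤ᵇ≡false j<i)))
                   (#-cong s (λ w _ → cong₂ (λ a b → a ∧ (lift G k (i + w) ∨ b))
                     (≤⇒≤ᵇ≡true (m≤m+n i w)) (forward-false (lift-forward G F) (≤-trans (<⇒≤ k<i) (m≤m+n i w))))) ⟩
    #[ w < s ] (lift G k (i + w) ∨ false)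
      ≡⟨ #-cong s (λ w _ → ∨-identityʳ _) ⟩
    #[ w < s ] lift G k (i + w)  ∎

  after-≤ : ∀ {k} → k < i → after k ≤ Δ
  after-≤ {k} k<i = ≤-trans (≤-reflexive (after-forward k<i)) (≤-trans (m≤n+m _ _)
    (subst (_≤ Δ) (∑-+ i s _) (out≤Δ k (<-≤-trans k<i (m≤m+n i s)))))

  early : ∀ k → k < i → 𝟙 (k <ᵇ i) * #[ l < Δ ] (l <ᵇ after k) ≡ #[ w < s ] lift G k (i + w)
  early k k<i rewrite <⇒<ᵇ≡true k<i =
    trans (+-identityʳ _) (trans (#-<ᵇ Δ (after k) (after-≤ k<i)) (after-forward k<i))

-- Splicing realisations

block : ℕ → Graph → Graph → Graph → Graph
block n E₁ B E₂ u v =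
  if u <ᵇ n then (if v <ᵇ n then E₁ u v else B u (v ∸ n))
            else (if v <ᵇ n then false else E₂ (u ∸ n) (v ∸ n))

below-or-offset : ∀ n u → u < n ⊎ Σ ℕ λ x → u ≡ n + x
below-or-offset n u with u <? n
... | yes u<n = inj₁ u<n
... | no  u≮n = inj₂ (u ∸ n , sym (m+[n∸m]≡n (≮⇒≥ u≮n)))

module Block (n₁ n₂ : ℕ) (E₁ B E₂ : Graph) where

  G : Graph
  G = block n₁ E₁ B E₂

  G-11 : ∀ {u v} → u < n₁ → v < n₁ → G u v ≡ E₁ u v
  G-11 u<n v<n rewrite <⇒<ᵇ≡true u<n | <⇒<ᵇ≡true v<n = refl

  G-12 : ∀ {u} y → u < n₁ → G u (n₁ + y) ≡ B u y
  G-12 {u} y u<n rewrite <⇒<ᵇ≡true u<n | ≥⇒<ᵇ≡false {n₁ + y} (m≤m+n n₁ y) | m+n∸m≡n n₁ y = refl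

  G-21 : ∀ x {v} → v < n₁ → G (n₁ + x) v ≡ false
  G-21 x v<n rewrite <⇒<ᵇ≡true v<n | ≥⇒<ᵇ≡false {n₁ + x} (m≤m+n n₁ x) = refl

  G-22 : ∀ x y → G (n₁ + x) (n₁ + y) ≡ E₂ x y
  G-22 x y rewrite ≥⇒<ᵇ≡false {n₁ + x} (m≤m+n n₁ x) | ≥⇒<ᵇ≡false {n₁ + y} (m≤m+n n₁ y)
                 | m+n∸m≡n n₁ x | m+n∸m≡n n₁ y = refl

  forward : Forwardℕ E₁ → Forwardℕ E₂ → Forwardℕ G
  forward F₁ F₂ u v Guv with below-or-offset n₁ u | below-or-offset n₁ v
  ... | inj₁ u<n       | inj₁ v<n       = F₁ u v (trans (sym (G-11 u<n v<n)) Guv)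
  ... | inj₁ u<n       | inj₂ (y , refl) = <-≤-trans u<n (m≤m+n n₁ y)
  ... | inj₂ (x , refl) | inj₁ v<n       with trans (sym (G-21 x v<n)) Guv
  ...   | ()
  forward F₁ F₂ u v Guv | inj₂ (x , refl) | inj₂ (y , refl) =
    +-monoʳ-< n₁ (F₂ x y (trans (sym (G-22 x y)) Guv))

  #-column-left : ∀ {v} → v < n₁ → #[ u < n₁ + n₂ ] G u v ≡ #[ u < n₁ ] E₁ u v
  #-column-left {v} v<n = begin
    #[ u < n₁ + n₂ ] G u v                          ≡⟨ ∑-+ n₁ n₂ _ ⟩
    #[ u < n₁ ] G u v + #[ x < n₂ ] G (n₁ + x) v    ≡⟨ cong₂ _+_ (#-cong n₁ (λ u u<n → G-11 u<n v<n)) (#-false n₂ (λ x _ → G-21 x v<n)) ⟩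
    #[ u < n₁ ] E₁ u v + 0                          ≡⟨ +-identityʳ _ ⟩
    #[ u < n₁ ] E₁ u v                              ∎
    where open ≡-Reasoning

  #-row-left : ∀ {u} → u < n₁ → #[ v < n₁ + n₂ ] G u v ≡ #[ v < n₁ ] E₁ u v + #[ y < n₂ ] B u y
  #-row-left {u} u<n = trans (∑-+ n₁ n₂ _)
    (cong₂ _+_ (#-cong n₁ (λ v v<n → G-11 u<n v<n)) (#-cong n₂ (λ y _ → G-12 y u<n)))

  #-column-right : ∀ y → #[ u < n₁ + n₂ ] G u (n₁ + y) ≡ #[ u < n₁ ] B u y + #[ x < n₂ ] E₂ x y
  #-column-right y = trans (∑-+ n₁ n₂ _)
    (cong₂ _+_ (#-cong n₁ (λ u u<n → G-12 y u<n)) (#-cong n₂ (λ x _ → G-22 x y)))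

  #-row-right : ∀ y → #[ v < n₁ + n₂ ] G (n₁ + y) v ≡ #[ x < n₂ ] E₂ y x
  #-row-right y = trans (∑-+ n₁ n₂ _)
    (cong₂ _+_ (#-false n₁ (λ v v<n → G-21 y v<n)) (#-cong n₂ (λ x _ → G-22 y x)))

block-realizes :
  ∀ ψ₁ ψ₂ {E₁ B E₂} → Forwardℕ E₁ → Forwardℕ E₂ →
  (∀ u → u < length ψ₁ →
     #[ v < length ψ₁ ] E₁ v u ≡ proj₁ (at ψ₁ u) ×
     #[ v < length ψ₁ ] E₁ u v + #[ y < length ψ₂ ] B u y ≡ proj₂ (at ψ₁ u)) →
  (∀ y → y < length ψ₂ →
     #[ u < length ψ₁ ] B u y + #[ x < length ψ₂ ] E₂ x y ≡ proj₁ (at ψ₂ y) ×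
     #[ x < length ψ₂ ] E₂ y x ≡ proj₂ (at ψ₂ y)) →
  RealizesInOrderℕ (ψ₁ ++ ψ₂) (block (length ψ₁) E₁ B E₂)
block-realizes ψ₁ ψ₂ {E₁} {B} {E₂} F₁ F₂ deg₁ deg₂ = forward F₁ F₂ , deg
  where
  open Block (length ψ₁) (length ψ₂) E₁ B E₂
  deg : ∀ k → k < length (ψ₁ ++ ψ₂) →
        #[ u < length (ψ₁ ++ ψ₂) ] G u k ≡ proj₁ (at (ψ₁ ++ ψ₂) k) ×
        #[ v < length (ψ₁ ++ ψ₂) ] G k v ≡ proj₂ (at (ψ₁ ++ ψ₂) k)
  deg k k<L rewrite length-++ ψ₁ {ψ₂} with below-or-offset (length ψ₁) k
  ... | inj₁ k<n₁ =
    trans (#-column-left k<n₁) (trans (proj₁ (deg₁ k k<n₁)) (cong proj₁ (sym (at-++ˡ ψ₁ ψ₂ k<n₁)))) ,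
    trans (#-row-left k<n₁) (trans (proj₂ (deg₁ k k<n₁)) (cong proj₂ (sym (at-++ˡ ψ₁ ψ₂ k<n₁))))
  ... | inj₂ (y , refl) =
    trans (#-column-right y) (trans (proj₁ (deg₂ y y<n₂)) (cong proj₁ (sym (at-++ʳ ψ₁ ψ₂ y)))) ,
    trans (#-row-right y) (trans (proj₂ (deg₂ y y<n₂)) (cong proj₂ (sym (at-++ʳ ψ₁ ψ₂ y))))
    where
    y<n₂ : y < length ψ₂
    y<n₂ = +-cancelˡ-< (length ψ₁) y (length ψ₂) k<L

splice-realizes :
  ∀ (ψ₁ ψ₂ φ : List Deg) {E F : Graph} i → i ≤ length φ →
  RealizesInOrderℕ (ψ₁ ++ ψ₂) E → RealizesInOrderℕ φ F → (B : Graph) →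
  (∀ u → u < length ψ₁ → #[ y < length (drop i φ) ] B u y ≡ #[ w < length ψ₂ ] E u (length ψ₁ + w)) →
  (∀ y → y < length (drop i φ) → #[ u < length ψ₁ ] B u y ≡ #[ k < i ] F k (i + y)) →
  RealizesInOrderℕ (ψ₁ ++ drop i φ) (block (length ψ₁) E B (λ x y → F (i + x) (i + y)))
splice-realizes ψ₁ ψ₂ φ {E} {F} i i≤n RE RF B B-rows B-columns =
  block-realizes ψ₁ (drop i φ) (proj₁ RE) tail-forward head-degrees tail-degrees
  where
  n₁ : ℕ
  n₁ = length ψ₁
  s : ℕ
  s = length (drop i φ)

  tail-forward : Forwardℕ (λ x y → F (i + x) (i + y))
  tail-forward x y Fxy = +-cancelˡ-< i x y (proj₁ RF _ _ Fxy)

  head-degrees : ∀ u → u < n₁ →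
    #[ v < n₁ ] E v u ≡ proj₁ (at ψ₁ u) × #[ v < n₁ ] E u v + #[ y < s ] B u y ≡ proj₂ (at ψ₁ u)
  head-degrees u u<n₁ with ++-prefix-degrees ψ₁ ψ₂ RE u u<n₁
  ... | in≡ , out≡ = in≡ , trans (cong (#[ v < n₁ ] E u v +_) (B-rows u u<n₁)) out≡

  tail-degrees : ∀ y → y < s →
    #[ u < n₁ ] B u y + #[ x < s ] F (i + x) (i + y) ≡ proj₁ (at (drop i φ) y) ×
    #[ x < s ] F (i + y) (i + x) ≡ proj₂ (at (drop i φ) y)
  tail-degrees y y<s with drop-degrees φ i i≤n RF y y<s
  ... | in≡ , out≡ = trans (cong (_+ #[ x < s ] F (i + x) (i + y)) (B-columns y y<s)) in≡ , out≡

splice-exists :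
  ∀ d (ψ₁ ψ₂ φ : List Deg) {E F : Graph} i → i ≤ length φ →
  Bounded (suc d) ψ₁ → Bounded (suc d) φ →
  RealizesInOrderℕ (ψ₁ ++ ψ₂) E → RealizesInOrderℕ φ F →
  ∑[ u < length ψ₁ ] #[ w < length ψ₂ ] E u (length ψ₁ + w) ≡ ∑[ k < i ] #[ w < length (drop i φ) ] F k (i + w) →
  suc d * suc d ≤ ∑[ u < length ψ₁ ] #[ w < length ψ₂ ] E u (length ψ₁ + w) →
  Σ Graph (RealizesInOrderℕ (ψ₁ ++ drop i φ))
splice-exists d ψ₁ ψ₂ φ {E} {F} i i≤n bounded₁ boundedφ RE RF crossing≡ D²≤crossing
  with bipartite-realization d (length ψ₁) (length (drop i φ)) c r c≤ r≤ ∑c≡∑r D²≤crossing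
  where
  c : ℕ → ℕ
  c u = #[ w < length ψ₂ ] E u (length ψ₁ + w)

  r : ℕ → ℕ
  r y = #[ k < i ] F k (i + y)

  c≤ : ∀ u → u < length ψ₁ → c u ≤ suc d
  c≤ u u<n₁ = ≤-trans (m≤n+m _ _) (subst (_≤ suc d) (sym (proj₂ (++-prefix-degrees ψ₁ ψ₂ RE u u<n₁)))
    (proj₂ (at-bounded ψ₁ bounded₁ u<n₁)))

  r≤ : ∀ y → y < length (drop i φ) → r y ≤ suc d
  r≤ y y<s = ≤-trans (m≤m+n _ _) (subst (_≤ suc d) (sym (proj₁ (drop-degrees φ i i≤n RF y y<s)))
    (proj₁ (at-bounded (drop i φ) (All.drop⁺ i boundedφ) y<s)))

  ∑c≡∑r : ∑ (length ψ₁) c ≡ ∑ (length (drop i φ)) r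
  ∑c≡∑r = trans crossing≡ (∑-comm i (length (drop i φ)) (λ k w → 𝟙 (F k (i + w))))
... | B , B-rows , B-columns = _ , splice-realizes ψ₁ ψ₂ φ i i≤n RE RF B B-rows B-columns

partialTO-zero-input :
  ∀ d {S p φ} → PartialTO (suc d) S (zeroPot (suc d)) p φ →
  φ ↭ S × Bounded (suc d) (φ ++ replicate (ω p) (1 , 0)) ×
  Σ (Adj (length (φ ++ replicate (ω p) (1 , 0)))) λ A →
    RealizesInOrder (φ ++ replicate (ω p) (1 , 0)) A × potential (suc d) A (length φ) ≡ p
partialTO-zero-input d (φ↭S , [] , _ , realized) = φ↭S , realized
-- a source has outdegree ≥ 1 and would be counted in p^s[1] = 0
partialTO-zero-input d (_ , suc b ∷ _ , (s≤s z≤n ∷ _ , count) , _) with count fzero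
... | ()

lemma7 : (Δ : ℕ) → 1 ≤ Δ →
         (φ : List Deg) (D : Adj (length φ)) →
         Bounded Δ φ → RealizesInOrder φ D →
         (i : ℕ) → 1 ≤ i → i ≤ length φ →
         Δ * Δ ≤ ω (potential Δ D i) →
         (S' φ' : List Deg) (p : Vec ℕ Δ) →
         PartialTO Δ S' (zeroPot Δ) p φ' →
         ω p ≡ ω (potential Δ D i) →
         RTOFor Δ (φ' ++ drop i φ) (S' ++ drop i φ)
lemma7 (suc d) (s≤s z≤n) φ D boundedφ RD i _ i≤n D²≤ω S' φ' p partialTO ωp≡ω
  with partialTO-zero-input d partialTO
... | φ'↭S' , boundedψ , A , RA , potential≡p =
  ↭.++⁺ʳ (drop i φ) φ'↭S' ,
  All.++⁺ (All.++⁻ˡ φ' boundedψ) (All.drop⁺ i boundedφ) ,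
  restrict-realizes {φ' ++ drop i φ} (splice-exists d φ' sinks φ i i≤n (All.++⁻ˡ φ' boundedψ) boundedφ RA′ RD′
    (trans (sym crossingA) (trans ωp≡ω crossingD)) (subst (suc d * suc d ≤_) (trans (sym ωp≡ω) crossingA) D²≤ω))
  where
  sinks : List Deg
  sinks = replicate (ω p) (1 , 0)
  RA′ : RealizesInOrderℕ (φ' ++ sinks) (lift A)
  RA′ = lift-realizes {φ' ++ sinks} RA
  RD′ : RealizesInOrderℕ φ (lift D)
  RD′ = lift-realizes {φ} RD
  crossingA : ω p ≡ ∑[ u < length φ' ] #[ w < length sinks ] lift A u (length φ' + w)
  crossingA = trans (cong ω (sym potential≡p))
    (ω-potential (suc d) A (proj₁ RA) (out-bounded boundedψ RA′) (length φ') (length sinks) (sym (length-++ φ')))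
  crossingD : ω (potential (suc d) D i) ≡ ∑[ k < i ] #[ w < length (drop i φ) ] lift D k (i + w)
  crossingD = ω-potential (suc d) D (proj₁ RD) (out-bounded boundedφ RD′) i (length (drop i φ)) (+-length-drop φ i≤n)
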